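{- Let $q=2^m$ with $m>1$, let $d$ be an odd positive integer and let $\gamma\in\mathbb{F}_{q^d}$. Then the polynomial $$f(x)=x+\gamma\,\mathrm{Tr}_q^{q^d}\!\left(x^{q+1}+x^{2q+2}\right)$$ is a permutation polynomial of $\mathbb{F}_{q^d}$ if and only if $\gamma\in\mathbb{F}_q$ and the equation $\gamma t^3+\gamma t+1=0$ has no solution $t\in\mathbb{F}_q$.
   Context: A polynomial over a finite field $\mathbb{F}$ is a permutation polynomial of $\mathbb{F}$ if the map it induces on $\mathbb{F}$ is a bijection. For $x\in\mathbb{F}_{q^d}$, $\mathrm{Tr}_q^{q^d}(x)=x+x^q+\cdots+x^{q^{d-1}}$. -}

module Defs where

open import Level using (Level; _⊔_)
open import Data.Nat using (ℕ; zero; suc; _^_)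
import Data.Nat
open import Data.Fin using (Fin)
open import Data.Product using (Σ; ∃; _×_)
open import Relation.Nullary using (¬_)
open import Relation.Binary.PropositionalEquality using (_≡_)
open import Algebra.Bundles using (CommutativeRing)

record Field (c ℓ : Level) : Set (Level.suc (c ⊔ ℓ)) where
  field
    commRing  : CommutativeRing c ℓ
  open CommutativeRing commRing public
  field
    1≉0       : ¬ (1# ≈ 0#)
    inverse   : ∀ x → ¬ (x ≈ 0#) → ∃ λ y → (x * y) ≈ 1#

module _ {c ℓ} (K : Field c ℓ) where
  open Field K

  pow : Carrier → ℕ → Carrier
  pow x zero    = 1#
  pow x (suc n) = x * pow x n

  HasCard : ℕ → Set (c ⊔ ℓ)
  HasCard N = Σ (Fin N → Carrier) λ e →
                (∀ i j → e i ≈ e j → i ≡ j) × (∀ x → ∃ λ i → e i ≈ x)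

  Tr : (q d : ℕ) → Carrier → Carrier
  Tr q zero    x = 0#
  Tr q (suc k) x = Tr q k x + pow x (q ^ k)

  IsPermutation : (Carrier → Carrier) → Set (c ⊔ ℓ)
  IsPermutation f = (∀ x y → f x ≈ f y → x ≈ y) × (∀ y → ∃ λ x → f x ≈ y)

  fpoly : (q d : ℕ) → Carrier → Carrier → Carrier
  fpoly q d γ x = x + γ * Tr q d (pow x (q Data.Nat.+ 1) + pow x (2 Data.Nat.* q Data.Nat.+ 2))

{-# OPTIONS --safe #-}
module Submission where

-- In K = F_{q^d} (characteristic 2, since |K| is even) put Q x = Tr(x^(q+1)) and
-- ℘ t = t + t², so that f x = x + γ ℘(Q x).  Both ℘ ∘ Q and Tr take values in F_q, and
-- f x = f y forces x = y + γ s with s ∈ F_q; moreover Q(y + γ s) = Q y + s B(γ, y) + s² Q γ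
-- with B(γ, y) = Tr(γ y^q + γ^q y).
-- If γ ∈ F_q then B(γ, ·) = 0 and Q γ = γ² (Tr 1 = 1 as d is odd), so t = γ s satisfies
-- t (γ t³ + γ t + 1) = 0; hence f is injective iff the cubic has no root in F_q (a root t gives
-- f t = 0 = f 0).  If γ ∉ F_q then B(γ, y) = Tr(β y) with β = γ^q + γ^(q^(d-1)) ≠ 0, so
-- B(γ, ·) is onto F_q and y can be chosen with f(y + γ s) = f y for s = ℘(Tr z) ≠ 0; such a z
-- exists because ℘ ∘ Tr is a polynomial of degree 2 q^(d-1) < q^d.  Finiteness of K also gives
-- x^(q^d) = x and injective ⇒ surjective.

open import Defs
open import Level using (_⊔_)
open import Data.Nat as ℕ using (ℕ; zero; suc; s≤s; z≤n)
import Data.Nat.Properties as ℕ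
open import Data.Fin as Fin using (Fin; punchIn; punchOut)
import Data.Fin.Properties as Fin
open import Data.Fin.Permutation using (Permutation; permutation)
open import Data.Product using (∃; _×_; _,_; proj₁; proj₂)
open import Data.Sum using (inj₁; inj₂)
open import Data.Empty using (⊥-elim)
open import Relation.Nullary using (¬_; Dec; yes; no)
open import Relation.Nullary.Decidable using (decidable-stable)
open import Relation.Binary.PropositionalEquality as ≡ using (_≡_)
open import Function using (_∘_)
open import Function.Bundles using (_⇔_; mk⇔)

module FieldProperties {c ℓ} (K : Field c ℓ) where
  open Field K public
  open import Relation.Binary.Reasoning.Setoid setoid public
  open import Algebra.Solver.Ring.NaturalCoefficients.Default commutativeSemiring public
    using (solve; _:=_; _:+_; _:*_; con)
  open import Algebra.Properties.Ring ring public
    using (+-cancelˡ; +-inverseˡ-unique; +-identityʳ-unique; x+x≈x⇒x≈0; x∙y⁻¹≈ε⇒x≈y; x[y-z]≈xy-xz; -1*x≈-x; -‿involutive)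
  open import Algebra.Properties.CommutativeSemigroup +-commutativeSemigroup public
    using () renaming (interchange to +-interchange)
  open import Algebra.Properties.CommutativeSemiring.Exp commutativeSemiring
    using (^-congˡ; ^-homo-*; ^-assocʳ; ^-distrib-*) renaming (_^_ to _^ˢ_)

  infixr 8 _^_
  _^_ : Carrier → ℕ → Carrier
  _^_ = pow K

  ^≈^ˢ : ∀ x n → x ^ n ≈ x ^ˢ n
  ^≈^ˢ x zero    = refl
  ^≈^ˢ x (suc n) = *-congˡ (^≈^ˢ x n)

  pow-congˡ : ∀ n {x y} → x ≈ y → x ^ n ≈ y ^ n
  pow-congˡ n {x} {y} x≈y = begin
    x ^ n  ≈⟨ ^≈^ˢ x n ⟩
    x ^ˢ n ≈⟨ ^-congˡ n x≈y ⟩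
    y ^ˢ n ≈⟨ ^≈^ˢ y n ⟨
    y ^ n  ∎

  pow-homo-* : ∀ x m n → x ^ (m ℕ.+ n) ≈ x ^ m * x ^ n
  pow-homo-* x m n = begin
    x ^ (m ℕ.+ n)    ≈⟨ ^≈^ˢ x (m ℕ.+ n) ⟩
    x ^ˢ (m ℕ.+ n)   ≈⟨ ^-homo-* x m n ⟩
    x ^ˢ m * x ^ˢ n  ≈⟨ *-cong (^≈^ˢ x m) (^≈^ˢ x n) ⟨
    x ^ m * x ^ n    ∎

  pow-assocʳ : ∀ x m n → (x ^ m) ^ n ≈ x ^ (m ℕ.* n)
  pow-assocʳ x m n = begin
    (x ^ m) ^ n    ≈⟨ ^≈^ˢ (x ^ m) n ⟩
    (x ^ m) ^ˢ n   ≈⟨ ^-congˡ n (^≈^ˢ x m) ⟩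
    (x ^ˢ m) ^ˢ n  ≈⟨ ^-assocʳ x m n ⟩
    x ^ˢ (m ℕ.* n) ≈⟨ ^≈^ˢ x (m ℕ.* n) ⟨
    x ^ (m ℕ.* n)  ∎

  pow-distrib-* : ∀ x y n → (x * y) ^ n ≈ x ^ n * y ^ n
  pow-distrib-* x y n = begin
    (x * y) ^ n       ≈⟨ ^≈^ˢ (x * y) n ⟩
    (x * y) ^ˢ n      ≈⟨ ^-distrib-* x y n ⟩
    x ^ˢ n * y ^ˢ n   ≈⟨ *-cong (^≈^ˢ x n) (^≈^ˢ y n) ⟨
    x ^ n * y ^ n     ∎

  pow-comm : ∀ x m n → (x ^ m) ^ n ≈ (x ^ n) ^ m
  pow-comm x m n = begin
    (x ^ m) ^ n   ≈⟨ pow-assocʳ x m n ⟩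
    x ^ (m ℕ.* n) ≡⟨ ≡.cong (x ^_) (ℕ.*-comm m n) ⟩
    x ^ (n ℕ.* m) ≈⟨ pow-assocʳ x n m ⟨
    (x ^ n) ^ m   ∎

  pow-1 : ∀ x → x ^ 1 ≈ x
  pow-1 = *-identityʳ

  1#-pow : ∀ n → 1# ^ n ≈ 1#
  1#-pow zero    = refl
  1#-pow (suc n) = trans (*-identityˡ _) (1#-pow n)

  0#-pow : ∀ n → 0# ^ suc n ≈ 0#
  0#-pow n = zeroˡ _

  AdditivePower : ℕ → Set (c ⊔ ℓ)
  AdditivePower a = ∀ x y → (x + y) ^ a ≈ x ^ a + y ^ a

  AdditivePower-1 : AdditivePower 1
  AdditivePower-1 x y = trans (pow-1 (x + y)) (sym (+-cong (pow-1 x) (pow-1 y)))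

  AdditivePower-* : ∀ {a b} → AdditivePower a → AdditivePower b → AdditivePower (a ℕ.* b)
  AdditivePower-* {a} {b} add-a add-b x y = begin
    (x + y) ^ (a ℕ.* b)                ≈⟨ pow-assocʳ (x + y) a b ⟨
    ((x + y) ^ a) ^ b                  ≈⟨ pow-congˡ b (add-a x y) ⟩
    (x ^ a + y ^ a) ^ b                ≈⟨ add-b (x ^ a) (y ^ a) ⟩
    (x ^ a) ^ b + (y ^ a) ^ b          ≈⟨ +-cong (pow-assocʳ x a b) (pow-assocʳ y a b) ⟩
    x ^ (a ℕ.* b) + y ^ (a ℕ.* b)      ∎

  AdditivePower-^ : ∀ {a} → AdditivePower a → ∀ k → AdditivePower (a ℕ.^ k)
  AdditivePower-^ add-a zero    = AdditivePower-1
  AdditivePower-^ {a} add-a (suc k) = AdditivePower-* {a} {a ℕ.^ k} add-a (AdditivePower-^ {a} add-a k)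

  AdditivePower⇒0#-pow : ∀ {a} → AdditivePower a → 0# ^ a ≈ 0#
  AdditivePower⇒0#-pow {a} add-a = x+x≈x⇒x≈0 (0# ^ a)
    (trans (sym (add-a 0# 0#)) (pow-congˡ a (+-identityʳ 0#)))

  x*y≈0⇒y≈0 : ∀ {x y} → ¬ x ≈ 0# → x * y ≈ 0# → y ≈ 0#
  x*y≈0⇒y≈0 {x} {y} x≉0 xy≈0 = begin
    y              ≈⟨ *-identityˡ y ⟨
    1# * y         ≈⟨ *-congʳ x′x≈1 ⟨
    (x′ * x) * y   ≈⟨ *-assoc x′ x y ⟩
    x′ * (x * y)   ≈⟨ *-congˡ xy≈0 ⟩
    x′ * 0#        ≈⟨ zeroʳ x′ ⟩
    0#             ∎
    where
    x′ = proj₁ (inverse x x≉0)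
    x′x≈1 : x′ * x ≈ 1#
    x′x≈1 = trans (*-comm x′ x) (proj₂ (inverse x x≉0))

  *-nonzero : ∀ {x y} → ¬ x ≈ 0# → ¬ y ≈ 0# → ¬ x * y ≈ 0#
  *-nonzero x≉0 y≉0 xy≈0 = y≉0 (x*y≈0⇒y≈0 x≉0 xy≈0)

  *-cancelˡ-nonzero : ∀ {a x y} → ¬ a ≈ 0# → a * x ≈ a * y → x ≈ y
  *-cancelˡ-nonzero {a} {x} {y} a≉0 ax≈ay = x∙y⁻¹≈ε⇒x≈y x y (x*y≈0⇒y≈0 a≉0 (begin
    a * (x - y)     ≈⟨ x[y-z]≈xy-xz a x y ⟩
    a * x - a * y   ≈⟨ +-congʳ ax≈ay ⟩
    a * y - a * y   ≈⟨ -‿inverseʳ (a * y) ⟩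
    0#              ∎))

  -1^even≈-1⇒1+1≈0 : ∀ t → (- 1#) ^ (2 ℕ.* t) ≈ - 1# → 1# + 1# ≈ 0#
  -1^even≈-1⇒1+1≈0 t -1^2t≈-1 = begin
    1# + 1#     ≈⟨ +-congˡ 1≈-1 ⟩
    1# + - 1#   ≈⟨ -‿inverseʳ 1# ⟩
    0#          ∎
    where
    1≈-1 : 1# ≈ - 1#
    1≈-1 = begin
      1#                   ≈⟨ 1#-pow t ⟨
      1# ^ t               ≈⟨ pow-congˡ t (trans (-1*x≈-x (- 1#)) (-‿involutive 1#)) ⟨
      (- 1# * - 1#) ^ t    ≈⟨ pow-congˡ t (*-congˡ (pow-1 (- 1#))) ⟨
      ((- 1#) ^ 2) ^ t     ≈⟨ pow-assocʳ (- 1#) 2 t ⟩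
      (- 1#) ^ (2 ℕ.* t)   ≈⟨ -1^2t≈-1 ⟩
      - 1#                 ∎

module PolynomialFunctions {c ℓ} (K : Field c ℓ) where
  open FieldProperties K

  -- IsPolyFun n a f: f is a polynomial function of formal degree n with
  -- coefficient a at xⁿ, presented by iterating the factor theorem.
  IsPolyFun : ℕ → Carrier → (Carrier → Carrier) → Set (c ⊔ ℓ)
  IsPolyFun zero    a f = ∀ x → f x ≈ a
  IsPolyFun (suc n) a f = ∀ b → ∃ λ g → IsPolyFun n a g × (∀ x → f x ≈ f b + (x - b) * g x)

  IsPolyFun-resp-≗ : ∀ n {a f g} → (∀ x → f x ≈ g x) → IsPolyFun n a f → IsPolyFun n a g
  IsPolyFun-resp-≗ zero    f≈g pf x = trans (sym (f≈g x)) (pf x)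
  IsPolyFun-resp-≗ (suc n) f≈g pf b with pf b
  ... | h , ph , f≈ = h , ph , λ x → trans (sym (f≈g x)) (trans (f≈ x) (+-congʳ (f≈g b)))

  IsPolyFun-resp-≈ : ∀ n {a a′ f} → a ≈ a′ → IsPolyFun n a f → IsPolyFun n a′ f
  IsPolyFun-resp-≈ zero    a≈a′ pf x = trans (pf x) a≈a′
  IsPolyFun-resp-≈ (suc n) a≈a′ pf b with pf b
  ... | h , ph , f≈ = h , IsPolyFun-resp-≈ n a≈a′ ph , f≈

  IsPolyFun-+ : ∀ n {a a′ f g} → IsPolyFun n a f → IsPolyFun n a′ g → IsPolyFun n (a + a′) (λ x → f x + g x)
  IsPolyFun-+ zero    pf pg x = +-cong (pf x) (pg x)
  IsPolyFun-+ (suc n) {f = f} {g} pf pg b with pf b | pg b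
  ... | f′ , pf′ , f≈ | g′ , pg′ , g≈ = (λ x → f′ x + g′ x) , IsPolyFun-+ n pf′ pg′ , λ x → begin
    f x + g x                                   ≈⟨ +-cong (f≈ x) (g≈ x) ⟩
    (f b + (x - b) * f′ x) + (g b + (x - b) * g′ x) ≈⟨ +-interchange _ _ _ _ ⟩
    (f b + g b) + ((x - b) * f′ x + (x - b) * g′ x) ≈⟨ +-congˡ (distribˡ (x - b) (f′ x) (g′ x)) ⟨
    (f b + g b) + (x - b) * (f′ x + g′ x)       ∎

  IsPolyFun-scale : ∀ n {a f} s → IsPolyFun n a f → IsPolyFun n (s * a) (λ x → s * f x)
  IsPolyFun-scale zero    s pf x = *-congˡ (pf x)
  IsPolyFun-scale (suc n) {f = f} s pf b with pf b
  ... | g , pg , f≈ = (λ x → s * g x) , IsPolyFun-scale n s pg , λ x → begin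
    s * f x                        ≈⟨ *-congˡ (f≈ x) ⟩
    s * (f b + (x - b) * g x)      ≈⟨ solve 4 (λ s fb z gx → s :* (fb :+ z :* gx) := s :* fb :+ z :* (s :* gx)) refl s (f b) (x - b) (g x) ⟩
    s * f b + (x - b) * (s * g x)  ∎

  IsPolyFun-lift : ∀ n {a f} → IsPolyFun n a f → IsPolyFun (suc n) 0# f
  IsPolyFun-lift zero {f = f} pf b = (λ _ → 0#) , (λ _ → refl) , λ x → begin
    f x                ≈⟨ trans (pf x) (sym (pf b)) ⟩
    f b                ≈⟨ +-identityʳ (f b) ⟨
    f b + 0#           ≈⟨ +-congˡ (zeroʳ (x - b)) ⟨
    f b + (x - b) * 0# ∎
  IsPolyFun-lift (suc n) pf b with pf b
  ... | g , pg , f≈ = g , IsPolyFun-lift n pg , f≈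

  IsPolyFun-raise : ∀ {m n a f} → IsPolyFun m a f → m ℕ.< n → IsPolyFun n 0# f
  IsPolyFun-raise {m} {suc n} pf (s≤s m≤n) with ℕ.m≤n⇒m<n∨m≡n m≤n
  ... | inj₁ m<n    = IsPolyFun-lift n (IsPolyFun-raise pf m<n)
  ... | inj₂ ≡.refl = IsPolyFun-lift m pf

  x≈b+[x-b] : ∀ x b → x ≈ b + (x - b)
  x≈b+[x-b] x b = begin
    x               ≈⟨ +-identityˡ x ⟨
    0# + x          ≈⟨ +-congʳ (-‿inverseʳ b) ⟨
    (b - b) + x     ≈⟨ solve 3 (λ b b′ x → (b :+ b′) :+ x := b :+ (x :+ b′)) refl b (- b) x ⟩
    b + (x - b)     ∎

  IsPolyFun-*x : ∀ n {a f} → IsPolyFun n a f → IsPolyFun (suc n) a (λ x → x * f x)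
  IsPolyFun-*x zero {f = f} pf b = f , pf , λ x → begin
    x * f x                   ≈⟨ *-congʳ (x≈b+[x-b] x b) ⟩
    (b + (x - b)) * f x       ≈⟨ distribʳ (f x) b (x - b) ⟩
    b * f x + (x - b) * f x   ≈⟨ +-congʳ (*-congˡ (trans (pf x) (sym (pf b)))) ⟩
    b * f b + (x - b) * f x   ∎
  IsPolyFun-*x (suc n) {a} {f} pf b with pf b
  ... | h , ph , f≈ = (λ x → f x + b * h x) , pg , λ x → begin
    x * f x                                    ≈⟨ *-congʳ (x≈b+[x-b] x b) ⟩
    (b + (x - b)) * f x                        ≈⟨ distribʳ (f x) b (x - b) ⟩
    b * f x + (x - b) * f x                    ≈⟨ +-congʳ (*-congˡ (f≈ x)) ⟩
    b * (f b + (x - b) * h x) + (x - b) * f x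
      ≈⟨ solve 5 (λ b fb z hx fx → b :* (fb :+ z :* hx) :+ z :* fx := b :* fb :+ z :* (fx :+ b :* hx)) refl b (f b) (x - b) (h x) (f x) ⟩
    b * f b + (x - b) * (f x + b * h x)        ∎
    where
    pg : IsPolyFun (suc n) a (λ x → f x + b * h x)
    pg = IsPolyFun-resp-≈ (suc n) (+-identityʳ a)
           (IsPolyFun-+ (suc n) pf (IsPolyFun-lift n (IsPolyFun-scale n b ph)))

  IsPolyFun-pow : ∀ n → IsPolyFun n 1# (_^ n)
  IsPolyFun-pow zero    _ = refl
  IsPolyFun-pow (suc n) = IsPolyFun-*x n (IsPolyFun-pow n)

  IsPolyFun⇒rootsBounded : ∀ n {a f} → IsPolyFun n a f → ¬ a ≈ 0# →
                            (r : Fin (suc n) → Carrier) → (∀ i j → r i ≈ r j → i ≡ j) →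
                            ¬ (∀ i → f (r i) ≈ 0#)
  IsPolyFun⇒rootsBounded zero    pf a≉0 r _ roots = a≉0 (trans (sym (pf (r Fin.zero))) (roots Fin.zero))
  IsPolyFun⇒rootsBounded (suc n) {f = f} pf a≉0 r r-inj roots with pf (r Fin.zero)
  ... | g , pg , f≈ = IsPolyFun⇒rootsBounded n pg a≉0 (r ∘ Fin.suc)
                        (λ i j rᵢ≈rⱼ → Fin.suc-injective (r-inj _ _ rᵢ≈rⱼ)) g-roots
    where
    g-roots : ∀ i → g (r (Fin.suc i)) ≈ 0#
    g-roots i = x*y≈0⇒y≈0 (λ d≈0 → Fin.0≢1+n (r-inj _ _ (sym (x∙y⁻¹≈ε⇒x≈y _ _ d≈0)))) (begin
      (ri - r₀) * g ri          ≈⟨ +-identityˡ _ ⟨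
      0# + (ri - r₀) * g ri     ≈⟨ +-congʳ (roots Fin.zero) ⟨
      f r₀ + (ri - r₀) * g ri   ≈⟨ f≈ ri ⟨
      f ri                      ≈⟨ roots (Fin.suc i) ⟩
      0#                        ∎)
      where
      r₀ = r Fin.zero
      ri = r (Fin.suc i)

Fin-injective⇒surjective : ∀ {n} (h : Fin n → Fin n) → (∀ i j → h i ≡ h j → i ≡ j) → ∀ j → ∃ λ i → h i ≡ j
Fin-injective⇒surjective {suc n} h h-inj j with Fin.any? (λ i → h i Fin.≟ j)
... | yes hit = hit
... | no  miss = ⊥-elim (ℕ.1+n≰n (Fin.injective⇒≤ h′-inj))
  where
  h′ : Fin (suc n) → Fin n
  h′ i = punchOut (λ j≡hi → miss (i , ≡.sym j≡hi))
  h′-inj : ∀ {a b} → h′ a ≡ h′ b → a ≡ b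
  h′-inj {a} {b} eq = h-inj a b (Fin.punchOut-injective {i = j} _ _ eq)

module FiniteField {c ℓ} (K : Field c ℓ) {n : ℕ} (card : HasCard K (suc n)) where
  open FieldProperties K
  open PolynomialFunctions K
  open import Algebra.Properties.CommutativeMonoid.Sum *-commutativeMonoid
    using (sum-remove; sum-permute; sum-cong-≋; ∑-distrib-+)
    renaming (sum to product)

  enum : Fin (suc n) → Carrier
  enum = proj₁ card

  enum-injective : ∀ i j → enum i ≈ enum j → i ≡ j
  enum-injective = proj₁ (proj₂ card)

  index : Carrier → Fin (suc n)
  index x = proj₁ (proj₂ (proj₂ card) x)

  enum-index : ∀ x → enum (index x) ≈ x
  enum-index x = proj₂ (proj₂ (proj₂ card) x)

  index-injective : ∀ {x y} → index x ≡ index y → x ≈ y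
  index-injective {x} {y} eq = trans (sym (enum-index x)) (trans (reflexive (≡.cong enum eq)) (enum-index y))

  infix 4 _≟_
  _≟_ : ∀ x y → Dec (x ≈ y)
  x ≟ y with index x Fin.≟ index y
  ... | yes eq = yes (index-injective eq)
  ... | no  ne = no λ x≈y → ne (enum-injective _ _ (trans (enum-index x) (trans x≈y (sym (enum-index y)))))

  injective⇒surjective : (f : Carrier → Carrier) → (∀ x y → f x ≈ f y → x ≈ y) → ∀ y → ∃ λ x → f x ≈ y
  injective⇒surjective f f-inj y with Fin-injective⇒surjective h h-inj (index y)
    where
    h : Fin (suc n) → Fin (suc n)
    h i = index (f (enum i))
    h-inj : ∀ i j → h i ≡ h j → i ≡ j
    h-inj i j eq = enum-injective i j (f-inj _ _ (index-injective eq))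
  ... | i , hi≡y = enum i , index-injective hi≡y

  -- Multiplying by a ≉ 0 permutes the elements; after zeroToOne the product over all
  -- elements becomes the (nonzero) product of the units, which that permutation scales by aⁿ.
  zeroToOne : Carrier → Carrier
  zeroToOne x with x ≟ 0#
  ... | yes _ = 1#
  ... | no  _ = x

  zeroToOne-cong : ∀ {x y} → x ≈ y → zeroToOne x ≈ zeroToOne y
  zeroToOne-cong {x} {y} x≈y with x ≟ 0# | y ≟ 0#
  ... | yes _   | yes _   = refl
  ... | yes x≈0 | no  y≉0 = ⊥-elim (y≉0 (trans (sym x≈y) x≈0))
  ... | no  x≉0 | yes y≈0 = ⊥-elim (x≉0 (trans x≈y y≈0))
  ... | no  _   | no  _   = x≈y

  zeroToOne-0# : ∀ {x} → x ≈ 0# → zeroToOne x ≈ 1#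
  zeroToOne-0# {x} x≈0 with x ≟ 0#
  ... | yes _   = refl
  ... | no  x≉0 = ⊥-elim (x≉0 x≈0)

  zeroToOne-nonzero : ∀ {x} → ¬ x ≈ 0# → zeroToOne x ≈ x
  zeroToOne-nonzero {x} x≉0 with x ≟ 0#
  ... | yes x≈0 = ⊥-elim (x≉0 x≈0)
  ... | no  _   = refl

  product-nonzero : ∀ {k} (g : Fin k → Carrier) → (∀ j → ¬ g j ≈ 0#) → ¬ product g ≈ 0#
  product-nonzero {zero}  g _    = 1≉0
  product-nonzero {suc k} g g≉0 = *-nonzero (g≉0 Fin.zero) (product-nonzero (g ∘ Fin.suc) (g≉0 ∘ Fin.suc))

  product-const : ∀ k a → product {k} (λ _ → a) ≈ a ^ k
  product-const zero    a = refl
  product-const (suc k) a = *-congˡ (product-const k a)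

  product-zeroToOne : (g : Fin (suc n) → Carrier) → g (index 0#) ≈ 0# → (∀ j → ¬ g (punchIn (index 0#) j) ≈ 0#) →
                      product (zeroToOne ∘ g) ≈ product (g ∘ punchIn (index 0#))
  product-zeroToOne g g₀≈0 g≉0 = begin
    product (zeroToOne ∘ g)
      ≈⟨ sum-remove (zeroToOne ∘ g) ⟩
    zeroToOne (g (index 0#)) * product (zeroToOne ∘ g ∘ punchIn (index 0#))
      ≈⟨ *-cong (zeroToOne-0# g₀≈0) (sum-cong-≋ (zeroToOne-nonzero ∘ g≉0)) ⟩
    1# * product (g ∘ punchIn (index 0#))
      ≈⟨ *-identityˡ _ ⟩
    product (g ∘ punchIn (index 0#))
      ∎

  units : Fin n → Carrier
  units = enum ∘ punchIn (index 0#)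

  units≉0 : ∀ j → ¬ units j ≈ 0#
  units≉0 j u≈0 = Fin.punchInᵢ≢i _ j (enum-injective _ _ (trans u≈0 (sym (enum-index 0#))))

  scale : Carrier → Fin (suc n) → Fin (suc n)
  scale a i = index (a * enum i)

  scale-inverse : ∀ {a a′} → a * a′ ≈ 1# → ∀ i → scale a (scale a′ i) ≡ i
  scale-inverse {a} {a′} aa′≈1 i = enum-injective _ _ (begin
    enum (scale a (scale a′ i))  ≈⟨ enum-index _ ⟩
    a * enum (scale a′ i)        ≈⟨ *-congˡ (enum-index _) ⟩
    a * (a′ * enum i)            ≈⟨ *-assoc a a′ (enum i) ⟨
    (a * a′) * enum i            ≈⟨ *-congʳ aa′≈1 ⟩
    1# * enum i                  ≈⟨ *-identityˡ (enum i) ⟩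
    enum i                       ∎)

  scaling : ∀ {a a′} → a * a′ ≈ 1# → Permutation (suc n) (suc n)
  scaling {a} {a′} aa′≈1 = permutation (scale a) (scale a′) (scale-inverse aa′≈1) (scale-inverse (trans (*-comm a′ a) aa′≈1))

  product-units-scale : ∀ {a} → ¬ a ≈ 0# → product units ≈ a ^ n * product units
  product-units-scale {a} a≉0 = begin
    product units                            ≈⟨ product-zeroToOne enum (enum-index 0#) units≉0 ⟨
    product (zeroToOne ∘ enum)               ≈⟨ sum-permute (zeroToOne ∘ enum) (scaling (proj₂ (inverse a a≉0))) ⟩
    product (zeroToOne ∘ enum ∘ scale a)     ≈⟨ sum-cong-≋ (λ i → zeroToOne-cong (enum-index (a * enum i))) ⟩
    product (λ i → zeroToOne (a * enum i))   ≈⟨ product-zeroToOne (λ i → a * enum i) a0≈0 (*-nonzero a≉0 ∘ units≉0) ⟩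
    product (λ j → a * units j)              ≈⟨ ∑-distrib-+ (λ _ → a) units ⟩
    product {n} (λ _ → a) * product units    ≈⟨ *-congʳ (product-const n a) ⟩
    a ^ n * product units                    ∎
    where
    a0≈0 : a * enum (index 0#) ≈ 0#
    a0≈0 = trans (*-congˡ (enum-index 0#)) (zeroʳ a)

  fermat : ∀ x → x ^ suc n ≈ x
  fermat x with x ≟ 0#
  ... | yes x≈0 = trans (pow-congˡ (suc n) x≈0) (trans (0#-pow n) (sym x≈0))
  ... | no  x≉0 = trans (*-congˡ xⁿ≈1) (*-identityʳ x)
    where
    xⁿ≈1 : x ^ n ≈ 1#
    xⁿ≈1 = *-cancelˡ-nonzero (product-nonzero units units≉0) (begin
      product units * x ^ n    ≈⟨ *-comm _ _ ⟩
      x ^ n * product units    ≈⟨ product-units-scale x≉0 ⟨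
      product units            ≈⟨ *-identityʳ _ ⟨
      product units * 1#       ∎)

  IsPolyFun⇒nonroot : ∀ {m a f} → IsPolyFun m a f → ¬ a ≈ 0# → m ℕ.< suc n → ∃ λ z → ¬ f z ≈ 0#
  IsPolyFun⇒nonroot {m} {f = f} pf a≉0 m<N
    with Fin.¬∀⟶∃¬ (suc n) (λ i → f (enum i) ≈ 0#) (λ i → f (enum i) ≟ 0#) noRootsOnSubset
    where
    noRootsOnSubset : ¬ (∀ i → f (enum i) ≈ 0#)
    noRootsOnSubset allRoots = IsPolyFun⇒rootsBounded m pf a≉0 (λ i → enum (Fin.inject≤ i m<N))
      (λ i j eq → Fin.inject≤-injective m<N m<N i j (enum-injective _ _ eq)) (λ i → allRoots _)
  ... | i , fᵢ≉0 = enum i , fᵢ≉0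

module CharacteristicTwo {c ℓ} (K : Field c ℓ) (1+1≈0 : Field._≈_ K (Field._+_ K (Field.1# K) (Field.1# K)) (Field.0# K)) where
  open FieldProperties K

  x+x≈0 : ∀ x → x + x ≈ 0#
  x+x≈0 x = begin
    x + x             ≈⟨ +-cong (*-identityˡ x) (*-identityˡ x) ⟨
    1# * x + 1# * x   ≈⟨ distribʳ x 1# 1# ⟨
    (1# + 1#) * x     ≈⟨ *-congʳ 1+1≈0 ⟩
    0# * x            ≈⟨ zeroˡ x ⟩
    0#                ∎

  x+y≈0⇒x≈y : ∀ {x y} → x + y ≈ 0# → x ≈ y
  x+y≈0⇒x≈y {x} {y} x+y≈0 = trans (+-inverseˡ-unique x y x+y≈0) (sym (+-inverseˡ-unique y y (x+x≈0 y)))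

  x+y≈z⇒x≈z+y : ∀ {x y z} → x + y ≈ z → x ≈ z + y
  x+y≈z⇒x≈z+y {x} {y} {z} x+y≈z = x+y≈0⇒x≈y (begin
    x + (z + y)         ≈⟨ +-congˡ (+-congʳ x+y≈z) ⟨
    x + ((x + y) + y)   ≈⟨ +-congˡ (trans (+-assoc x y y) (trans (+-congˡ (x+x≈0 y)) (+-identityʳ x))) ⟩
    x + x               ≈⟨ x+x≈0 x ⟩
    0#                  ∎)

  AdditivePower-2 : AdditivePower 2
  AdditivePower-2 x y = begin
    (x + y) ^ 2
      ≈⟨ solve 2 (λ x y → (x :+ y) :* ((x :+ y) :* con 1)
                       := (x :* (x :* con 1) :+ y :* (y :* con 1)) :+ (x :* y :+ x :* y)) refl x y ⟩
    (x ^ 2 + y ^ 2) + (x * y + x * y)   ≈⟨ +-congˡ (x+x≈0 (x * y)) ⟩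
    (x ^ 2 + y ^ 2) + 0#                ≈⟨ +-identityʳ _ ⟩
    x ^ 2 + y ^ 2                       ∎

module Trace {c ℓ} (K : Field c ℓ) (1+1≈0 : Field._≈_ K (Field._+_ K (Field.1# K) (Field.1# K)) (Field.0# K)) (q d : ℕ)
             (q-additive : FieldProperties.AdditivePower K q) (q^d-fixes : ∀ x → Field._≈_ K (pow K x (q ℕ.^ d)) x) where
  open FieldProperties K
  open CharacteristicTwo K 1+1≈0

  tr : ℕ → Carrier → Carrier
  tr = Tr K q

  infix 4 _∈Fq
  _∈Fq : Carrier → Set ℓ
  x ∈Fq = x ^ q ≈ x

  ∈Fq-0# : 0# ∈Fq
  ∈Fq-0# = AdditivePower⇒0#-pow {q} q-additive

  ∈Fq-+ : ∀ {x y} → x ∈Fq → y ∈Fq → x + y ∈Fq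
  ∈Fq-+ x∈ y∈ = trans (q-additive _ _) (+-cong x∈ y∈)

  ∈Fq-* : ∀ {x y} → x ∈Fq → y ∈Fq → x * y ∈Fq
  ∈Fq-* x∈ y∈ = trans (pow-distrib-* _ _ q) (*-cong x∈ y∈)

  ∈Fq-pow : ∀ {x} → x ∈Fq → ∀ n → x ^ n ∈Fq
  ∈Fq-pow {x} x∈ n = trans (pow-comm x n q) (pow-congˡ n x∈)

  ∈Fq-inverse : ∀ {x y} → x ∈Fq → x * y ≈ 1# → y ∈Fq
  ∈Fq-inverse {x} {y} x∈ xy≈1 = *-cancelˡ-nonzero x≉0 (begin
    x * y ^ q        ≈⟨ *-congʳ x∈ ⟨
    x ^ q * y ^ q    ≈⟨ pow-distrib-* x y q ⟨
    (x * y) ^ q      ≈⟨ pow-congˡ q xy≈1 ⟩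
    1# ^ q           ≈⟨ 1#-pow q ⟩
    1#               ≈⟨ xy≈1 ⟨
    x * y            ∎)
    where
    x≉0 : ¬ x ≈ 0#
    x≉0 x≈0 = 1≉0 (trans (sym xy≈1) (trans (*-congʳ x≈0) (zeroˡ y)))

  ∈Fq-pow-q^ : ∀ {x} → x ∈Fq → ∀ k → x ^ (q ℕ.^ k) ≈ x
  ∈Fq-pow-q^ {x} x∈ zero    = pow-1 x
  ∈Fq-pow-q^ {x} x∈ (suc k) = begin
    x ^ (q ℕ.* q ℕ.^ k)  ≈⟨ pow-assocʳ x q (q ℕ.^ k) ⟨
    (x ^ q) ^ (q ℕ.^ k)  ≈⟨ pow-congˡ (q ℕ.^ k) x∈ ⟩
    x ^ (q ℕ.^ k)        ≈⟨ ∈Fq-pow-q^ x∈ k ⟩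
    x                    ∎

  tr-cong : ∀ k {x y} → x ≈ y → tr k x ≈ tr k y
  tr-cong zero    x≈y = refl
  tr-cong (suc k) x≈y = +-cong (tr-cong k x≈y) (pow-congˡ (q ℕ.^ k) x≈y)

  tr-+ : ∀ k x y → tr k (x + y) ≈ tr k x + tr k y
  tr-+ zero    x y = sym (+-identityʳ 0#)
  tr-+ (suc k) x y = begin
    tr k (x + y) + (x + y) ^ (q ℕ.^ k)                     ≈⟨ +-cong (tr-+ k x y) (AdditivePower-^ {q} q-additive k x y) ⟩
    (tr k x + tr k y) + (x ^ (q ℕ.^ k) + y ^ (q ℕ.^ k))    ≈⟨ +-interchange _ _ _ _ ⟩
    (tr k x + x ^ (q ℕ.^ k)) + (tr k y + y ^ (q ℕ.^ k))    ∎

  tr-scale : ∀ k {a} → a ∈Fq → ∀ x → tr k (a * x) ≈ a * tr k x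
  tr-scale zero    a∈ x = sym (zeroʳ _)
  tr-scale (suc k) {a} a∈ x = begin
    tr k (a * x) + (a * x) ^ (q ℕ.^ k)   ≈⟨ +-cong (tr-scale k a∈ x) (trans (pow-distrib-* a x (q ℕ.^ k)) (*-congʳ (∈Fq-pow-q^ a∈ k))) ⟩
    a * tr k x + a * x ^ (q ℕ.^ k)       ≈⟨ distribˡ a _ _ ⟨
    a * (tr k x + x ^ (q ℕ.^ k))         ∎

  tr-pow : ∀ {a} → AdditivePower a → ∀ k x → tr k x ^ a ≈ tr k (x ^ a)
  tr-pow {a} add-a zero    x = AdditivePower⇒0#-pow {a} add-a
  tr-pow {a} add-a (suc k) x = begin
    (tr k x + x ^ (q ℕ.^ k)) ^ a              ≈⟨ add-a _ _ ⟩
    tr k x ^ a + (x ^ (q ℕ.^ k)) ^ a          ≈⟨ +-cong (tr-pow {a} add-a k x) (pow-comm x (q ℕ.^ k) a) ⟩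
    tr k (x ^ a) + (x ^ a) ^ (q ℕ.^ k)        ∎

  tr-suc : ∀ k x → tr (suc k) x ≈ x + tr k (x ^ q)
  tr-suc zero    x = trans (+-identityˡ _) (trans (pow-1 x) (sym (+-identityʳ x)))
  tr-suc (suc k) x = begin
    tr (suc k) x + x ^ (q ℕ.* q ℕ.^ k)               ≈⟨ +-cong (tr-suc k x) (sym (pow-assocʳ x q (q ℕ.^ k))) ⟩
    (x + tr k (x ^ q)) + (x ^ q) ^ (q ℕ.^ k)         ≈⟨ +-assoc _ _ _ ⟩
    x + tr (suc k) (x ^ q)                           ∎

  tr-pow-q : ∀ x → tr d (x ^ q) ≈ tr d x
  tr-pow-q x = +-cancelˡ x _ _ (begin
    x + tr d (x ^ q)          ≈⟨ tr-suc d x ⟨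
    tr d x + x ^ (q ℕ.^ d)    ≈⟨ +-congˡ (q^d-fixes x) ⟩
    tr d x + x                ≈⟨ +-comm _ _ ⟩
    x + tr d x                ∎)

  tr-∈Fq : ∀ x → tr d x ∈Fq
  tr-∈Fq x = trans (tr-pow {q} q-additive d x) (tr-pow-q x)

  tr-2+-1# : ∀ k → tr (2 ℕ.+ k) 1# ≈ tr k 1#
  tr-2+-1# k = begin
    (tr k 1# + 1# ^ (q ℕ.^ k)) + 1# ^ (q ℕ.^ suc k)  ≈⟨ +-cong (+-congˡ (1#-pow (q ℕ.^ k))) (1#-pow (q ℕ.^ suc k)) ⟩
    (tr k 1# + 1#) + 1#                              ≈⟨ +-assoc _ _ _ ⟩
    tr k 1# + (1# + 1#)                              ≈⟨ +-congˡ 1+1≈0 ⟩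
    tr k 1# + 0#                                     ≈⟨ +-identityʳ _ ⟩
    tr k 1#                                          ∎

  tr-1#-odd : ∀ k → tr (1 ℕ.+ 2 ℕ.* k) 1# ≈ 1#
  tr-1#-odd zero    = trans (+-identityˡ _) (pow-1 1#)
  tr-1#-odd (suc k) = begin
    tr (1 ℕ.+ 2 ℕ.* suc k) 1#        ≡⟨ ≡.cong (λ j → tr (1 ℕ.+ j) 1#) (ℕ.*-suc 2 k) ⟩
    tr (2 ℕ.+ (1 ℕ.+ 2 ℕ.* k)) 1#    ≈⟨ tr-2+-1# (1 ℕ.+ 2 ℕ.* k) ⟩
    tr (1 ℕ.+ 2 ℕ.* k) 1#            ≈⟨ tr-1#-odd k ⟩
    1#                               ∎

  tr-onto : ∀ z → ¬ tr d z ≈ 0# → ∀ {M} → M ∈Fq → ∃ λ y → tr d y ≈ M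
  tr-onto z tr≉0 {M} M∈ = (M * w′) * z , (begin
      tr d ((M * w′) * z)   ≈⟨ tr-scale d (∈Fq-* M∈ (∈Fq-inverse (tr-∈Fq z) ww′≈1)) z ⟩
      (M * w′) * tr d z     ≈⟨ *-assoc M w′ (tr d z) ⟩
      M * (w′ * tr d z)     ≈⟨ *-congˡ (trans (*-comm w′ (tr d z)) ww′≈1) ⟩
      M * 1#                ≈⟨ *-identityʳ M ⟩
      M                     ∎)
    where
    w′ = proj₁ (inverse (tr d z) tr≉0)
    ww′≈1 : tr d z * w′ ≈ 1#
    ww′≈1 = proj₂ (inverse (tr d z) tr≉0)

  x^q^2≈x⇒x^q^even≈x : ∀ {x} → (x ^ q) ^ q ≈ x → ∀ j → x ^ (q ℕ.^ (2 ℕ.* j)) ≈ x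
  x^q^2≈x⇒x^q^even≈x {x} x^q^2≈x zero    = pow-1 x
  x^q^2≈x⇒x^q^even≈x {x} x^q^2≈x (suc j) = begin
    x ^ (q ℕ.^ (2 ℕ.* suc j))               ≡⟨ ≡.cong (λ e → x ^ (q ℕ.^ e)) (ℕ.*-suc 2 j) ⟩
    x ^ (q ℕ.* (q ℕ.* q ℕ.^ (2 ℕ.* j)))     ≈⟨ pow-assocʳ x q _ ⟨
    (x ^ q) ^ (q ℕ.* q ℕ.^ (2 ℕ.* j))       ≈⟨ pow-assocʳ (x ^ q) q _ ⟨
    ((x ^ q) ^ q) ^ (q ℕ.^ (2 ℕ.* j))       ≈⟨ pow-congˡ (q ℕ.^ (2 ℕ.* j)) x^q^2≈x ⟩
    x ^ (q ℕ.^ (2 ℕ.* j))                   ≈⟨ x^q^2≈x⇒x^q^even≈x x^q^2≈x j ⟩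
    x                                       ∎

  ℘ : Carrier → Carrier
  ℘ t = t + t ^ 2

  ℘-cong : ∀ {s t} → s ≈ t → ℘ s ≈ ℘ t
  ℘-cong s≈t = +-cong s≈t (pow-congˡ 2 s≈t)

  ℘-+ : ∀ s t → ℘ (s + t) ≈ ℘ s + ℘ t
  ℘-+ s t = trans (+-congˡ (AdditivePower-2 s t)) (+-interchange s t (s ^ 2) (t ^ 2))

  ℘-∈Fq : ∀ {t} → t ∈Fq → ℘ t ∈Fq
  ℘-∈Fq t∈ = ∈Fq-+ t∈ (∈Fq-pow t∈ 2)

  Q : Carrier → Carrier
  Q x = tr d (x ^ (q ℕ.+ 1))

  B : Carrier → Carrier → Carrier
  B g y = tr d (g * y ^ q + g ^ q * y)

  Q-cong : ∀ {x y} → x ≈ y → Q x ≈ Q y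
  Q-cong x≈y = tr-cong d (pow-congˡ (q ℕ.+ 1) x≈y)

  x^[q+1]≈x^q*x : ∀ x → x ^ (q ℕ.+ 1) ≈ x ^ q * x
  x^[q+1]≈x^q*x x = trans (pow-homo-* x q 1) (*-congˡ (pow-1 x))

  Q-translate : ∀ y g {s} → s ∈Fq → Q (y + g * s) ≈ Q y + (s * B g y + s ^ 2 * Q g)
  Q-translate y g {s} s∈ = begin
    tr d ((y + g * s) ^ (q ℕ.+ 1))                                   ≈⟨ tr-cong d expand ⟩
    tr d (y ^ (q ℕ.+ 1) + (s * W + s ^ 2 * g ^ (q ℕ.+ 1)))           ≈⟨ tr-+ d _ _ ⟩
    Q y + tr d (s * W + s ^ 2 * g ^ (q ℕ.+ 1))                       ≈⟨ +-congˡ (tr-+ d _ _) ⟩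
    Q y + (tr d (s * W) + tr d (s ^ 2 * g ^ (q ℕ.+ 1)))              ≈⟨ +-congˡ (+-cong (tr-scale d s∈ W) (tr-scale d (∈Fq-pow s∈ 2) _)) ⟩
    Q y + (s * B g y + s ^ 2 * Q g)                                  ∎
    where
    W = g * y ^ q + g ^ q * y
    expand : (y + g * s) ^ (q ℕ.+ 1) ≈ y ^ (q ℕ.+ 1) + (s * W + s ^ 2 * g ^ (q ℕ.+ 1))
    expand = begin
      (y + g * s) ^ (q ℕ.+ 1)               ≈⟨ x^[q+1]≈x^q*x _ ⟩
      (y + g * s) ^ q * (y + g * s)         ≈⟨ *-congʳ (trans (q-additive _ _) (+-congˡ (trans (pow-distrib-* g s q) (*-congˡ s∈)))) ⟩
      (y ^ q + g ^ q * s) * (y + g * s)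
        ≈⟨ solve 5 (λ Y G y g s → (Y :+ G :* s) :* (y :+ g :* s)
                               := Y :* y :+ (s :* (g :* Y :+ G :* y) :+ (s :* (s :* con 1)) :* (G :* g)))
                   refl (y ^ q) (g ^ q) y g s ⟩
      y ^ q * y + (s * W + s ^ 2 * (g ^ q * g))  ≈⟨ +-cong (x^[q+1]≈x^q*x y) (+-congˡ (*-congˡ (x^[q+1]≈x^q*x g))) ⟨
      y ^ (q ℕ.+ 1) + (s * W + s ^ 2 * g ^ (q ℕ.+ 1)) ∎

  module _ (γ : Carrier) where
    private
      F = fpoly K q d γ

    fpoly≈ : ∀ x → F x ≈ x + γ * ℘ (Q x)
    fpoly≈ x = +-congˡ (*-congˡ (begin
      tr d (x ^ (q ℕ.+ 1) + x ^ (2 ℕ.* q ℕ.+ 2))   ≈⟨ tr-+ d _ _ ⟩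
      Q x + tr d (x ^ (2 ℕ.* q ℕ.+ 2))             ≡⟨ ≡.cong (λ e → Q x + tr d (x ^ e)) 2q+2≡[q+1]*2 ⟩
      Q x + tr d (x ^ ((q ℕ.+ 1) ℕ.* 2))           ≈⟨ +-congˡ (tr-cong d (pow-assocʳ x (q ℕ.+ 1) 2)) ⟨
      Q x + tr d ((x ^ (q ℕ.+ 1)) ^ 2)             ≈⟨ +-congˡ (tr-pow {2} AdditivePower-2 d _) ⟨
      ℘ (Q x)                                      ∎))
      where
      2q+2≡[q+1]*2 : 2 ℕ.* q ℕ.+ 2 ≡ (q ℕ.+ 1) ℕ.* 2
      2q+2≡[q+1]*2 = ≡.trans (≡.sym (ℕ.*-distribˡ-+ 2 q 1)) (ℕ.*-comm 2 (q ℕ.+ 1))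

    fpoly-cong : ∀ {x y} → x ≈ y → F x ≈ F y
    fpoly-cong {x} {y} x≈y = trans (fpoly≈ x) (trans (+-cong x≈y (*-congˡ (℘-cong (Q-cong x≈y)))) (sym (fpoly≈ y)))

    fpoly-translate : ∀ y {s} → s ∈Fq → F (y + γ * s) ≈ F y + γ * (s + ℘ (s * B γ y + s ^ 2 * Q γ))
    fpoly-translate y {s} s∈ = begin
      F (y + γ * s)                                  ≈⟨ fpoly≈ (y + γ * s) ⟩
      (y + γ * s) + γ * ℘ (Q (y + γ * s))            ≈⟨ +-congˡ (*-congˡ (℘-cong (Q-translate y γ s∈))) ⟩
      (y + γ * s) + γ * ℘ (Q y + δ)                  ≈⟨ +-congˡ (*-congˡ (℘-+ (Q y) δ)) ⟩
      (y + γ * s) + γ * (℘ (Q y) + ℘ δ)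
        ≈⟨ solve 5 (λ y g s a b → (y :+ g :* s) :+ g :* (a :+ b) := (y :+ g :* a) :+ g :* (s :+ b)) refl y γ s (℘ (Q y)) (℘ δ) ⟩
      (y + γ * ℘ (Q y)) + γ * (s + ℘ δ)              ≈⟨ +-congʳ (fpoly≈ y) ⟨
      F y + γ * (s + ℘ δ)                            ∎
      where
      δ = s * B γ y + s ^ 2 * Q γ

    fpoly-collision : ∀ {x y} → F x ≈ F y → x ≈ y + γ * (℘ (Q y) + ℘ (Q x))
    fpoly-collision {x} {y} Fx≈Fy = begin
      x                                    ≈⟨ x+y≈z⇒x≈z+y (trans (sym (fpoly≈ x)) (trans Fx≈Fy (fpoly≈ y))) ⟩
      (y + γ * ℘ (Q y)) + γ * ℘ (Q x)      ≈⟨ +-assoc _ _ _ ⟩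
      y + (γ * ℘ (Q y) + γ * ℘ (Q x))      ≈⟨ +-congˡ (distribˡ γ _ _) ⟨
      y + γ * (℘ (Q y) + ℘ (Q x))          ∎

module PermutationCriterion {c ℓ} (K : Field c ℓ) (m k : ℕ) (1<m : 1 ℕ.< m)
               (card : HasCard K ((2 ℕ.^ m) ℕ.^ (1 ℕ.+ 2 ℕ.* k))) where
  open FieldProperties K
  open PolynomialFunctions K

  q d N : ℕ
  q = 2 ℕ.^ m
  d = 1 ℕ.+ 2 ℕ.* k
  N = q ℕ.^ d

  instance
    q≢0 : ℕ.NonZero q
    q≢0 = ℕ.m^n≢0 2 m

  2<q : 2 ℕ.< q
  2<q = ℕ.^-monoʳ-< 2 (s≤s (s≤s z≤n)) 1<m

  N≢0 : ℕ.NonZero N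
  N≢0 = ℕ.m^n≢0 q d

  open FiniteField K (≡.subst (HasCard K) (≡.sym (ℕ.suc-pred N {{N≢0}})) card) public
    using (_≟_; injective⇒surjective; fermat; IsPolyFun⇒nonroot)

  x^N≈x : ∀ x → x ^ N ≈ x
  x^N≈x x = ≡.subst (λ e → x ^ e ≈ x) (ℕ.suc-pred N {{N≢0}}) (fermat x)

  N-even : ∃ λ t → N ≡ 2 ℕ.* t
  N-even = even m 1<m
    where
    even : ∀ m → 1 ℕ.< m → ∃ λ t → (2 ℕ.^ m) ℕ.^ d ≡ 2 ℕ.* t
    even (suc m′) _ = 2 ℕ.^ m′ ℕ.* (2 ℕ.^ suc m′) ℕ.^ (2 ℕ.* k) , ℕ.*-assoc 2 (2 ℕ.^ m′) _

  1+1≈0 : 1# + 1# ≈ 0#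
  1+1≈0 = -1^even≈-1⇒1+1≈0 (proj₁ N-even) (≡.subst (λ e → (- 1#) ^ e ≈ - 1#) (proj₂ N-even) (x^N≈x (- 1#)))

  open CharacteristicTwo K 1+1≈0
  open Trace K 1+1≈0 q d (AdditivePower-^ {2} AdditivePower-2 m) x^N≈x public

  Q-∈Fq : ∀ {x} → x ∈Fq → Q x ≈ x * x
  Q-∈Fq {x} x∈ = begin
    tr d (x ^ (q ℕ.+ 1))   ≈⟨ tr-cong d (trans (x^[q+1]≈x^q*x x) (trans (*-congʳ x∈) (sym (*-identityʳ _)))) ⟩
    tr d ((x * x) * 1#)    ≈⟨ tr-scale d (∈Fq-* x∈ x∈) 1# ⟩
    (x * x) * tr d 1#      ≈⟨ *-congˡ (tr-1#-odd k) ⟩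
    (x * x) * 1#           ≈⟨ *-identityʳ _ ⟩
    x * x                  ∎

  H : ℕ → Carrier → Carrier
  H j x = ℘ (tr j x)

  H-suc : ∀ j x → H (suc j) x ≈ H j x + (x ^ (q ℕ.^ j) + x ^ (q ℕ.^ j ℕ.* 2))
  H-suc j x = begin
    ℘ (tr j x + x ^ (q ℕ.^ j))                                 ≈⟨ ℘-+ _ _ ⟩
    H j x + (x ^ (q ℕ.^ j) + (x ^ (q ℕ.^ j)) ^ 2)              ≈⟨ +-congˡ (+-congˡ (pow-assocʳ x (q ℕ.^ j) 2)) ⟩
    H j x + (x ^ (q ℕ.^ j) + x ^ (q ℕ.^ j ℕ.* 2))              ∎

  H-extend : ∀ j {D a} → IsPolyFun D a (H j) → D ℕ.< q ℕ.^ j ℕ.* 2 → IsPolyFun (q ℕ.^ j ℕ.* 2) 1# (H (suc j))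
  H-extend j {D} H-poly D< = IsPolyFun-resp-≗ _ (λ x → sym (H-suc j x))
    (IsPolyFun-resp-≈ _ (trans (+-identityˡ _) (+-identityˡ _))
      (IsPolyFun-+ _ (IsPolyFun-raise H-poly D<)
        (IsPolyFun-+ _ (IsPolyFun-raise (IsPolyFun-pow (q ℕ.^ j)) Q<2Q) (IsPolyFun-pow (q ℕ.^ j ℕ.* 2)))))
    where
    Q<2Q : q ℕ.^ j ℕ.< q ℕ.^ j ℕ.* 2
    Q<2Q = ℕ.m<m*n (q ℕ.^ j) 2 {{ℕ.m^n≢0 q j}} (s≤s (s≤s z≤n))

  H-degree : ∀ j → IsPolyFun (q ℕ.^ j ℕ.* 2) 1# (H (suc j))
  H-degree zero    = H-extend 0 H0≈0 (s≤s z≤n)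
    where
    H0≈0 : IsPolyFun 0 0# (H 0)
    H0≈0 _ = trans (+-identityˡ _) (0#-pow 1)
  H-degree (suc j) = H-extend (suc j) (H-degree j)
    (ℕ.*-monoˡ-< 2 (ℕ.^-monoʳ-< q (ℕ.<-trans (s≤s (s≤s z≤n)) 2<q) (ℕ.n<1+n j)))

  -- The only place where q > 2, i.e. m > 1, is needed.
  H-degree<N : q ℕ.^ (2 ℕ.* k) ℕ.* 2 ℕ.< suc (ℕ.pred N)
  H-degree<N = ℕ.<-≤-trans (ℕ.*-monoʳ-< (q ℕ.^ (2 ℕ.* k)) {{ℕ.m^n≢0 q (2 ℕ.* k)}} 2<q)
    (ℕ.≤-reflexive (≡.trans (ℕ.*-comm (q ℕ.^ (2 ℕ.* k)) q) (≡.sym (ℕ.suc-pred N {{N≢0}}))))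

  ∃-℘[tr]≉0 : ∃ λ z → ¬ ℘ (tr d z) ≈ 0#
  ∃-℘[tr]≉0 = IsPolyFun⇒nonroot (H-degree (2 ℕ.* k)) 1≉0 H-degree<N

  z₀ : Carrier
  z₀ = proj₁ ∃-℘[tr]≉0

  ℘[tr[z₀]]≉0 : ¬ ℘ (tr d z₀) ≈ 0#
  ℘[tr[z₀]]≉0 = proj₂ ∃-℘[tr]≉0

  tr[z₀]≉0 : ¬ tr d z₀ ≈ 0#
  tr[z₀]≉0 tr≈0 = ℘[tr[z₀]]≉0 (trans (℘-cong tr≈0) (trans (+-identityˡ _) (0#-pow 1)))

  [x^q^2k]^q≈x : ∀ x → (x ^ (q ℕ.^ (2 ℕ.* k))) ^ q ≈ x
  [x^q^2k]^q≈x x = begin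
    (x ^ (q ℕ.^ (2 ℕ.* k))) ^ q   ≈⟨ pow-assocʳ x (q ℕ.^ (2 ℕ.* k)) q ⟩
    x ^ (q ℕ.^ (2 ℕ.* k) ℕ.* q)   ≡⟨ ≡.cong (x ^_) (ℕ.*-comm (q ℕ.^ (2 ℕ.* k)) q) ⟩
    x ^ N                         ≈⟨ x^N≈x x ⟩
    x                             ∎

  module _ (γ : Carrier) where
    private
      F = fpoly K q d γ

    Injective : Set (c ⊔ ℓ)
    Injective = ∀ x y → F x ≈ F y → x ≈ y

    cubic : Carrier → Carrier
    cubic t = (γ * t ^ 3 + γ * t) + 1#

    cubic-cong : ∀ {s t} → s ≈ t → cubic s ≈ cubic t
    cubic-cong s≈t = +-congʳ (+-cong (*-congˡ (pow-congˡ 3 s≈t)) (*-congˡ s≈t))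

    cubic-0# : cubic 0# ≈ 1#
    cubic-0# = solve 1 (λ g → (g :* (con 0 :* (con 0 :* (con 0 :* con 1))) :+ g :* con 0) :+ con 1 := con 1) refl γ

    RootInFq : Set (c ⊔ ℓ)
    RootInFq = ∃ λ t → t ∈Fq × cubic t ≈ 0#

    t+γ℘[t²]≈t*cubic : ∀ t → t + γ * ℘ (t * t) ≈ t * cubic t
    t+γ℘[t²]≈t*cubic t = solve 2 (λ t g → t :+ g :* (t :* t :+ (t :* t) :* ((t :* t) :* con 1))
                                    := t :* ((g :* (t :* (t :* (t :* con 1))) :+ g :* t) :+ con 1)) refl t γ

    F-∈Fq : ∀ {x} → x ∈Fq → F x ≈ x * cubic x
    F-∈Fq {x} x∈ = begin
      F x                     ≈⟨ fpoly≈ γ x ⟩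
      x + γ * ℘ (Q x)         ≈⟨ +-congˡ (*-congˡ (℘-cong (Q-∈Fq x∈))) ⟩
      x + γ * ℘ (x * x)       ≈⟨ t+γ℘[t²]≈t*cubic x ⟩
      x * cubic x             ∎

    injective⇒noRootInFq : Injective → ¬ RootInFq
    injective⇒noRootInFq inj (t , t∈ , root) = 1≉0 (begin
      1#          ≈⟨ cubic-0# ⟨
      cubic 0#    ≈⟨ cubic-cong (sym t≈0) ⟩
      cubic t     ≈⟨ root ⟩
      0#          ∎)
      where
      t≈0 : t ≈ 0#
      t≈0 = inj t 0# (begin
        F t              ≈⟨ F-∈Fq t∈ ⟩
        t * cubic t      ≈⟨ *-congˡ root ⟩
        t * 0#           ≈⟨ zeroʳ t ⟩
        0#               ≈⟨ zeroˡ _ ⟨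
        0# * cubic 0#    ≈⟨ F-∈Fq ∈Fq-0# ⟨
        F 0#             ∎)

    B-∈Fq : γ ∈Fq → ∀ y → B γ y ≈ 0#
    B-∈Fq γ∈ y = begin
      tr d (γ * y ^ q + γ ^ q * y)          ≈⟨ tr-+ d _ _ ⟩
      tr d (γ * y ^ q) + tr d (γ ^ q * y)   ≈⟨ +-cong (tr-scale d γ∈ _) (tr-cong d (*-congʳ γ∈)) ⟩
      γ * tr d (y ^ q) + tr d (γ * y)       ≈⟨ +-cong (*-congˡ (tr-pow-q y)) (tr-scale d γ∈ y) ⟩
      γ * tr d y + γ * tr d y               ≈⟨ x+x≈0 _ ⟩
      0#                                    ∎

    γ∈Fq⇒injective : γ ∈Fq → ¬ RootInFq → Injective
    γ∈Fq⇒injective γ∈ noRoot x y Fx≈Fy = begin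
      x         ≈⟨ x≈y+t ⟩
      y + t     ≈⟨ +-congˡ t≈0 ⟩
      y + 0#    ≈⟨ +-identityʳ y ⟩
      y         ∎
      where
      s = ℘ (Q y) + ℘ (Q x)
      t = γ * s
      x≈y+t : x ≈ y + t
      x≈y+t = fpoly-collision γ Fx≈Fy
      s∈ : s ∈Fq
      s∈ = ∈Fq-+ (℘-∈Fq (tr-∈Fq _)) (℘-∈Fq (tr-∈Fq _))
      δ≈t*t : s * B γ y + s ^ 2 * Q γ ≈ t * t
      δ≈t*t = begin
        s * B γ y + s ^ 2 * Q γ    ≈⟨ +-cong (*-congˡ (B-∈Fq γ∈ y)) (*-congˡ (Q-∈Fq γ∈)) ⟩
        s * 0# + s ^ 2 * (γ * γ)   ≈⟨ solve 2 (λ s g → s :* con 0 :+ (s :* (s :* con 1)) :* (g :* g) := (g :* s) :* (g :* s)) refl s γ ⟩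
        t * t                      ∎
      γ[s+℘[t²]]≈0 : γ * (s + ℘ (t * t)) ≈ 0#
      γ[s+℘[t²]]≈0 = +-identityʳ-unique (F y) _ (begin
        F y + γ * (s + ℘ (t * t))                     ≈⟨ +-congˡ (*-congˡ (+-congˡ (℘-cong δ≈t*t))) ⟨
        F y + γ * (s + ℘ (s * B γ y + s ^ 2 * Q γ))   ≈⟨ fpoly-translate γ y s∈ ⟨
        F (y + t)                                     ≈⟨ fpoly-cong γ x≈y+t ⟨
        F x                                           ≈⟨ Fx≈Fy ⟩
        F y                                           ∎)
      t*cubic≈0 : t * cubic t ≈ 0#
      t*cubic≈0 = begin
        t * cubic t                  ≈⟨ t+γ℘[t²]≈t*cubic t ⟨
        γ * s + γ * ℘ (t * t)        ≈⟨ distribˡ γ s _ ⟨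
        γ * (s + ℘ (t * t))          ≈⟨ γ[s+℘[t²]]≈0 ⟩
        0#                           ∎
      t≈0 : t ≈ 0#
      t≈0 = decidable-stable (t ≟ 0#) (λ t≉0 → noRoot (t , ∈Fq-* γ∈ s∈ , x*y≈0⇒y≈0 t≉0 t*cubic≈0))

    -- γ′ = γ^(q^(2k)) is the conjugate with γ′^q = γ, which turns B γ into a trace form.
    β : Carrier
    β = γ ^ q + γ ^ (q ℕ.^ (2 ℕ.* k))

    B≈tr[β*] : ∀ y → B γ y ≈ tr d (β * y)
    B≈tr[β*] y = begin
      tr d (γ * y ^ q + γ ^ q * y)              ≈⟨ tr-+ d _ _ ⟩
      tr d (γ * y ^ q) + tr d (γ ^ q * y)       ≈⟨ +-congʳ (tr-cong d γy^q≈[γ′y]^q) ⟩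
      tr d ((γ′ * y) ^ q) + tr d (γ ^ q * y)    ≈⟨ +-congʳ (tr-pow-q (γ′ * y)) ⟩
      tr d (γ′ * y) + tr d (γ ^ q * y)          ≈⟨ tr-+ d _ _ ⟨
      tr d (γ′ * y + γ ^ q * y)                 ≈⟨ tr-cong d (trans (+-comm _ _) (sym (distribʳ y _ _))) ⟩
      tr d (β * y)                              ∎
      where
      γ′ = γ ^ (q ℕ.^ (2 ℕ.* k))
      γy^q≈[γ′y]^q : γ * y ^ q ≈ (γ′ * y) ^ q
      γy^q≈[γ′y]^q = trans (*-congʳ (sym ([x^q^2k]^q≈x γ))) (sym (pow-distrib-* γ′ y q))

    β≉0 : ¬ γ ∈Fq → ¬ β ≈ 0#
    β≉0 γ∉ β≈0 = γ∉ (trans γ^q≈γ′ (x^q^2≈x⇒x^q^even≈x γ^q^q≈γ k))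
      where
      γ^q≈γ′ : γ ^ q ≈ γ ^ (q ℕ.^ (2 ℕ.* k))
      γ^q≈γ′ = x+y≈0⇒x≈y β≈0
      γ^q^q≈γ : (γ ^ q) ^ q ≈ γ
      γ^q^q≈γ = trans (pow-congˡ q γ^q≈γ′) ([x^q^2k]^q≈x γ)

    B-onto : ¬ γ ∈Fq → ∀ {M} → M ∈Fq → ∃ λ y → B γ y ≈ M
    B-onto γ∉ M∈ = β′ * y₀ , trans (B≈tr[β*] (β′ * y₀)) (trans (tr-cong d ββ′y₀≈y₀) (proj₂ preimage))
      where
      preimage = tr-onto z₀ tr[z₀]≉0 M∈
      y₀ = proj₁ preimage
      β′ = proj₁ (inverse β (β≉0 γ∉))
      ββ′y₀≈y₀ : β * (β′ * y₀) ≈ y₀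
      ββ′y₀≈y₀ = trans (sym (*-assoc β β′ y₀)) (trans (*-congʳ (proj₂ (inverse β (β≉0 γ∉)))) (*-identityˡ y₀))

    B-solve : ¬ γ ∈Fq → ∀ {s w} → s ∈Fq → ¬ s ≈ 0# → w ∈Fq → ∃ λ y → s * B γ y + s ^ 2 * Q γ ≈ w
    B-solve γ∉ {s} {w} s∈ s≉0 w∈ = y , (begin
      s * B γ y + s ^ 2 * a                      ≈⟨ +-congʳ (*-congˡ Bγy≈M) ⟩
      s * ((w + s ^ 2 * a) * s′) + s ^ 2 * a     ≈⟨ +-congʳ (solve 3 (λ s s′ e → s :* (e :* s′) := (s :* s′) :* e) refl s s′ (w + s ^ 2 * a)) ⟩
      (s * s′) * (w + s ^ 2 * a) + s ^ 2 * a     ≈⟨ +-congʳ (trans (*-congʳ ss′≈1) (*-identityˡ _)) ⟩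
      (w + s ^ 2 * a) + s ^ 2 * a                ≈⟨ +-assoc _ _ _ ⟩
      w + (s ^ 2 * a + s ^ 2 * a)                ≈⟨ trans (+-congˡ (x+x≈0 _)) (+-identityʳ w) ⟩
      w                                          ∎)
      where
      a = Q γ
      s′ = proj₁ (inverse s s≉0)
      ss′≈1 : s * s′ ≈ 1#
      ss′≈1 = proj₂ (inverse s s≉0)
      M = (w + s ^ 2 * a) * s′
      M∈ : M ∈Fq
      M∈ = ∈Fq-* (∈Fq-+ w∈ (∈Fq-* (∈Fq-pow s∈ 2) (tr-∈Fq _))) (∈Fq-inverse s∈ ss′≈1)
      y = proj₁ (B-onto γ∉ M∈)
      Bγy≈M : B γ y ≈ M
      Bγy≈M = proj₂ (B-onto γ∉ M∈)

    γ∉Fq⇒¬injective : ¬ γ ∈Fq → ¬ Injective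
    γ∉Fq⇒¬injective γ∉ inj = *-nonzero γ≉0 ℘[tr[z₀]]≉0 (+-identityʳ-unique y _ (inj _ _ collision))
      where
      s = ℘ (tr d z₀)
      s∈ : s ∈Fq
      s∈ = ℘-∈Fq (tr-∈Fq z₀)
      γ≉0 : ¬ γ ≈ 0#
      γ≉0 γ≈0 = γ∉ (trans (pow-congˡ q γ≈0) (trans ∈Fq-0# (sym γ≈0)))
      solution = B-solve γ∉ s∈ ℘[tr[z₀]]≉0 (tr-∈Fq z₀)
      y = proj₁ solution
      collision : F (y + γ * s) ≈ F y
      collision = begin
        F (y + γ * s)                               ≈⟨ fpoly-translate γ y s∈ ⟩
        F y + γ * (s + ℘ (s * B γ y + s ^ 2 * Q γ)) ≈⟨ +-congˡ (*-congˡ (+-congˡ (℘-cong (proj₂ solution)))) ⟩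
        F y + γ * (s + s)                           ≈⟨ +-congˡ (trans (*-congˡ (x+x≈0 s)) (zeroʳ γ)) ⟩
        F y + 0#                                    ≈⟨ +-identityʳ _ ⟩
        F y                                         ∎

    injective⇒γ∈Fq : Injective → γ ∈Fq
    injective⇒γ∈Fq inj = decidable-stable (γ ^ q ≟ γ) (λ γ∉ → γ∉Fq⇒¬injective γ∉ inj)

open import Data.Nat using (_+_; _*_; _^_; _>_)

theorem4p1 : ∀ {c ℓ} (m d : ℕ) → m > 1 → (∃ λ k → d ≡ 1 + 2 * k)
    → (K : Field c ℓ) → HasCard K ((2 ^ m) ^ d) → (γ : Field.Carrier K)
    → IsPermutation K (fpoly K (2 ^ m) d γ)
      ⇔ ((Field._≈_ K (pow K γ (2 ^ m)) γ)
         × ¬ (∃ λ t → (Field._≈_ K (pow K t (2 ^ m)) t)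
                × Field._≈_ K (Field._+_ K (Field._+_ K (Field._*_ K γ (pow K t 3)) (Field._*_ K γ t)) (Field.1# K)) (Field.0# K)))
theorem4p1 m d 1<m (k , ≡.refl) K card γ = mk⇔
  (λ (inj , _) → injective⇒γ∈Fq γ inj , injective⇒noRootInFq γ inj)
  (λ (γ∈ , noRoot) → let inj = γ∈Fq⇒injective γ γ∈ noRoot in inj , injective⇒surjective _ inj)
  where open PermutationCriterion K m k 1<m card
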